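{- Let $X=MD(G,S_0,S_1,T_0,T_1)$ be a strongly connected mixed Cayley digraph with $\lambda(X)<\delta(X)$, let $A$ be a $\lambda$-atom of $X$, and let $Y=X[A]$ be the subdigraph induced by $A$. Then $\mathrm{Aut}(Y)$ acts transitively on $A_0$ and on $A_1$, where $A_i=A\cap X_i$ for $i=0,1$.
   Context: $G$ is a finite group with identity $1_G$, $S_0,S_1\subseteq G\setminus\{1_G\}$, $T_0,T_1\subseteq G$. The mixed Cayley digraph $X=MD(G,S_0,S_1,T_0,T_1)$ has vertex set $G\times\{0,1\}$ and arcs $((g,i),(sg,i))$ for $g\in G$, $s\in S_i$, $i=0,1$; $((g,0),(tg,1))$ for $g\in G$, $t\in T_0$; and $((tg,1),(g,0))$ for $g\in G$, $t\in T_1$. $X_i=G\times\{i\}$. $\delta(X)$ is the minimum over all vertices of all in-degrees and out-degrees; $\lambda(X)$ is the arc-connectivity (minimum number of arcs whose removal leaves a non-strongly-connected digraph). For $A\subseteq V(X)$, $\omega^+(A)$ (resp. $\omega^-(A)$) is the set of arcs from $A$ to $V(X)\setminus A$ (resp. from $V(X)\setminus A$ to $A$). A proper nonempty $A\subseteq V(X)$ is a positive (resp. negative) arc fragment if $|\omega^+(A)|=\lambda(X)$ (resp. $|\omega^-(A)|=\lambda(X)$); an arc fragment is either of these. A $\lambda$-atom is an arc fragment of least possible cardinality. -}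

module Defs where

open import Data.Nat using (ℕ; zero; suc; _+_; _≤_; _<_)
open import Data.Fin using (Fin; zero; suc)
open import Data.Bool using (Bool; true; false; _∧_; not; if_then_else_; T)
open import Data.Product using (Σ; _×_; _,_; proj₁; proj₂; ∃)
open import Data.Sum using (_⊎_)
open import Relation.Nullary using (¬_)
open import Relation.Binary.PropositionalEquality using (_≡_)
open import Relation.Binary.Construct.Closure.ReflexiveTransitive using (Star)
open import Algebra.Structures using (IsGroup)
open import Function.Definitions using (Bijective)

-- The finite group G is represented on the carrier Fin n (every finite
-- group is isomorphic to such a one); subsets of G are Bool-valued
-- predicates (decidable subsets).
record MixedCayley : Set where
  field
    n       : ℕ
    _∙_     : Fin n → Fin n → Fin n
    ε       : Fin n
    _⁻¹     : Fin n → Fin n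
    isGroup : IsGroup _≡_ _∙_ ε _⁻¹
    S₀ S₁ T₀ T₁ : Fin n → Bool
    S₀-no-id : S₀ ε ≡ false
    S₁-no-id : S₁ ε ≡ false

module _ (X : MixedCayley) where
  open MixedCayley X

  -- vertices G × {0,1}; layer 0 = false, layer 1 = true
  Vertex : Set
  Vertex = Fin n × Bool

  -- arcs:  ((g,i),(sg,i)) for s ∈ S_i ;  ((g,0),(tg,1)) for t ∈ T₀ ;
  --        ((tg,1),(g,0)) for t ∈ T₁.
  -- (g,i)→(h,j) is an arc iff the unique candidate t = h g⁻¹ (resp. the
  -- source-times-target-inverse for 1→0) lies in the relevant set.
  arc : Vertex → Vertex → Bool
  arc (g , false) (h , false) = S₀ (h ∙ (g ⁻¹))
  arc (g , true)  (h , true)  = S₁ (h ∙ (g ⁻¹))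
  arc (g , false) (h , true)  = T₀ (h ∙ (g ⁻¹))
  arc (h , true)  (g , false) = T₁ (h ∙ (g ⁻¹))

sumFin : ∀ {m} → (Fin m → ℕ) → ℕ
sumFin {zero}  f = 0
sumFin {suc m} f = f zero + sumFin (λ i → f (suc i))

module _ (X : MixedCayley) where
  open MixedCayley X

  sumV : (Vertex X → ℕ) → ℕ
  sumV f = sumFin (λ g → f (g , false)) + sumFin (λ g → f (g , true))

  countV : (Vertex X → Bool) → ℕ
  countV p = sumV (λ v → if p v then 1 else 0)

  countPairs : (Vertex X → Vertex X → Bool) → ℕ
  countPairs r = sumV (λ u → countV (r u))

  outdeg indeg : Vertex X → ℕ
  outdeg v = countV (arc X v)
  indeg  v = countV (λ u → arc X u v)

  IsMinDegree : ℕ → Set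
  IsMinDegree d = (∃ λ v → outdeg v ≡ d ⊎ indeg v ≡ d)
                × (∀ v → d ≤ outdeg v × d ≤ indeg v)

  StronglyConnectedRel : (Vertex X → Vertex X → Bool) → Set
  StronglyConnectedRel E = ∀ u v → Star (λ x y → T (E x y)) u v

  StronglyConnected : Set
  StronglyConnected = StronglyConnectedRel (arc X)

  deleteArcs : (Vertex X → Vertex X → Bool) → Vertex X → Vertex X → Bool
  deleteArcs F u v = arc X u v ∧ not (F u v)

  arcsIn : (Vertex X → Vertex X → Bool) → ℕ
  arcsIn F = countPairs (λ u v → arc X u v ∧ F u v)

  IsArcConnectivity : ℕ → Set
  IsArcConnectivity k =
      (∃ λ F → ¬ StronglyConnectedRel (deleteArcs F) × arcsIn F ≡ k)
    × (∀ F → ¬ StronglyConnectedRel (deleteArcs F) → k ≤ arcsIn F)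

  VSubset : Set
  VSubset = Vertex X → Bool

  ProperNonempty : VSubset → Set
  ProperNonempty A = (∃ λ u → A u ≡ true) × (∃ λ v → A v ≡ false)

  ωout ωin : VSubset → ℕ
  ωout A = countPairs (λ u v → A u ∧ not (A v) ∧ arc X u v)
  ωin  A = countPairs (λ u v → not (A u) ∧ A v ∧ arc X u v)

  IsPositiveArcFragment IsNegativeArcFragment IsArcFragment : ℕ → VSubset → Set
  IsPositiveArcFragment k A = ProperNonempty A × ωout A ≡ k
  IsNegativeArcFragment k A = ProperNonempty A × ωin A ≡ k
  IsArcFragment k A = IsPositiveArcFragment k A ⊎ IsNegativeArcFragment k A

  IsLambdaAtom : ℕ → VSubset → Set
  IsLambdaAtom k A = IsArcFragment k A
                   × (∀ B → IsArcFragment k B → countV A ≤ countV B)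

  InducedVertex : VSubset → Set
  InducedVertex A = Σ (Vertex X) (λ v → T (A v))

  IsAutomorphism : (A : VSubset) → (InducedVertex A → InducedVertex A) → Set
  IsAutomorphism A f =
      Bijective _≡_ _≡_ f
    × (∀ u v → arc X (proj₁ u) (proj₁ v) ≡ arc X (proj₁ (f u)) (proj₁ (f v)))

  AutTransitiveOnLayer : VSubset → Bool → Set
  AutTransitiveOnLayer A i =
    ∀ (x y : InducedVertex A) → proj₂ (proj₁ x) ≡ i
      → proj₂ (proj₁ y) ≡ i
      → ∃ λ f → IsAutomorphism A f × f x ≡ y

-- Right multiplication (g,i) ↦ (gc,i) is an automorphism of X fixing both layers, and
-- c = g⁻¹h carries (g,i) to (h,i). It therefore suffices that the image B of a λ-atom A under
-- such a translation equals A as soon as B meets A. Now B is again an atom, and |ω⁺|, |ω⁻| are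
-- submodular. An atom contains at most half of the vertices, so A ∩ B ≠ ∅ forces
-- |A ∪ B| < |V(X)|; then A ∩ B and A ∪ B are proper and nonempty, submodularity makes A ∩ B a
-- fragment, and minimality of |A| gives A = A ∩ B = B.
module Submission where

open import Defs
open import Data.Nat using (ℕ; _<_)
open import Data.Bool using (true; false)
open import Data.Product using (_×_)

open import Algebra.Bundles using (Group)
open import Algebra.Structures using (IsGroup)
open import Level using (0ℓ)
import Algebra.Properties.CommutativeMonoid.Sum as CommutativeMonoidSum
import Algebra.Properties.CommutativeSemigroup as CommutativeSemigroupProperties
import Algebra.Properties.Group as GroupProperties
open import Data.Bool using (Bool; _∧_; _∨_; not; if_then_else_; T; _≟_)
open import Data.Bool.Properties using (∧-comm; ∧-assoc; not-involutive; ¬-not; T-irrelevant; T-≡)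
open import Data.Fin using (Fin; zero; suc)
open import Data.Fin.Permutation using (Permutation′; permutation; _⟨$⟩ʳ_)
open import Data.Fin.Properties using (all?; ¬∀⟶∃¬)
open import Data.Nat using (zero; suc; _+_; _≤_; z≤n)
open import Data.Nat.Properties
  using (≤-refl; ≤-antisym; ≤-<-trans; +-comm; <⇒≱; <⇒≢; +-mono-≤; +-monoʳ-≤; +-mono-<-≤; +-mono-≤-<;
         +-cancelʳ-≤; m<n+m; +-0-commutativeMonoid; +-commutativeSemigroup; module ≤-Reasoning)
open import Data.Product using (Σ; _,_; proj₁; proj₂; ∃)
open import Data.Sum using (_⊎_; inj₁; inj₂)
open import Function using (_∘_; id; Equivalence)
open import Relation.Binary.Construct.Closure.ReflexiveTransitive using (Star; fold)
open import Relation.Binary.PropositionalEquality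
open import Relation.Nullary using (¬_; yes; no; contradiction)

open CommutativeMonoidSum +-0-commutativeMonoid using (sum; ∑-distrib-+; sum-permute)
open CommutativeSemigroupProperties +-commutativeSemigroup using (interchange)

𝟙 : Bool → ℕ
𝟙 b = if b then 1 else 0

𝟙-∧-∨ : ∀ a b → 𝟙 (a ∧ b) + 𝟙 (a ∨ b) ≡ 𝟙 a + 𝟙 b
𝟙-∧-∨ false b     = refl
𝟙-∧-∨ true  false = refl
𝟙-∧-∨ true  true  = refl

𝟙-not : ∀ a → 𝟙 a + 𝟙 (not a) ≡ 1
𝟙-not false = refl
𝟙-not true  = refl

not-∧ : ∀ a b → not (a ∧ b) ≡ not a ∨ not b
not-∧ false b = refl
not-∧ true  b = refl

not-∨ : ∀ a b → not (a ∨ b) ≡ not a ∧ not b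
not-∨ false b = refl
not-∨ true  b = refl

cut : Bool → Bool → Bool
cut a a′ = a ∧ not a′

𝟙-cut-submodular : ∀ x a b a′ b′ →
    𝟙 (x ∧ cut (a ∧ b) (a′ ∧ b′)) + 𝟙 (x ∧ cut (a ∨ b) (a′ ∨ b′))
  ≤ 𝟙 (x ∧ cut a a′) + 𝟙 (x ∧ cut b b′)
𝟙-cut-submodular false _     _     _     _     = z≤n
𝟙-cut-submodular true  false false a′    b′    = z≤n
𝟙-cut-submodular true  false true  false false = ≤-refl
𝟙-cut-submodular true  false true  false true  = z≤n
𝟙-cut-submodular true  false true  true  b′    = z≤n
𝟙-cut-submodular true  true  false false false = ≤-refl
𝟙-cut-submodular true  true  false false true  = z≤n
𝟙-cut-submodular true  true  false true  b′    = z≤n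
𝟙-cut-submodular true  true  true  false b′    = ≤-refl
𝟙-cut-submodular true  true  true  true  false = ≤-refl
𝟙-cut-submodular true  true  true  true  true  = z≤n

uncut-true⇒true : ∀ x a b → T (x ∧ not (cut a b)) → a ≡ true → b ≡ true
uncut-true⇒true _     _    true  _  _  = refl
uncut-true⇒true false _    false () _
uncut-true⇒true true  true false () _

module _ {V : Set} where

  _∩_ _∪_ : (V → Bool) → (V → Bool) → V → Bool
  (C ∩ D) v = C v ∧ D v
  (C ∪ D) v = C v ∨ D v

  ∁ : (V → Bool) → V → Bool
  ∁ C v = not (C v)

  _⊆_ : (V → Bool) → (V → Bool) → Set
  C ⊆ D = ∀ v → C v ≡ true → D v ≡ true

  ∩-⊆ˡ : ∀ C D → (C ∩ D) ⊆ C
  ∩-⊆ˡ C D v _ with C v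
  ... | true = refl

  ∩-⊆ʳ : ∀ C D → (C ∩ D) ⊆ D
  ∩-⊆ʳ C D v C∩Dv with C v
  ... | true = C∩Dv

  ∩-⊆-∪ : ∀ C D → (C ∩ D) ⊆ (C ∪ D)
  ∩-⊆-∪ C D v C∩Dv rewrite ∩-⊆ˡ C D v C∩Dv = refl

  ⊆-∉ : ∀ {C D} → C ⊆ D → ∀ v → D v ≡ false → C v ≡ false
  ⊆-∉ {C} C⊆D v Dv with C v in Cv
  ... | false = refl
  ... | true  = contradiction (trans (sym (C⊆D v Cv)) Dv) λ ()

sumFin≡sum : ∀ {m} (f : Fin m → ℕ) → sumFin f ≡ sum f
sumFin≡sum {zero}  f = refl
sumFin≡sum {suc m} f = cong (f zero +_) (sumFin≡sum (f ∘ suc))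

sumFin-cong : ∀ {m} {f g : Fin m → ℕ} → (∀ i → f i ≡ g i) → sumFin f ≡ sumFin g
sumFin-cong {zero}  f≗g = refl
sumFin-cong {suc m} f≗g = cong₂ _+_ (f≗g zero) (sumFin-cong (f≗g ∘ suc))

sumFin-mono-≤ : ∀ {m} {f g : Fin m → ℕ} → (∀ i → f i ≤ g i) → sumFin f ≤ sumFin g
sumFin-mono-≤ {zero}  f≤g = z≤n
sumFin-mono-≤ {suc m} f≤g = +-mono-≤ (f≤g zero) (sumFin-mono-≤ (f≤g ∘ suc))

sumFin-mono-< : ∀ {m} {f g : Fin m → ℕ} → (∀ i → f i ≤ g i) → ∀ j → f j < g j → sumFin f < sumFin g
sumFin-mono-< {suc m} f≤g zero    fj<gj = +-mono-<-≤ fj<gj (sumFin-mono-≤ (f≤g ∘ suc))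
sumFin-mono-< {suc m} f≤g (suc j) fj<gj = +-mono-≤-< (f≤g zero) (sumFin-mono-< (f≤g ∘ suc) j fj<gj)

sumFin-distrib-+ : ∀ {m} (f g : Fin m → ℕ) → sumFin (λ i → f i + g i) ≡ sumFin f + sumFin g
sumFin-distrib-+ f g = begin
  sumFin (λ i → f i + g i) ≡⟨ sumFin≡sum (λ i → f i + g i) ⟩
  sum (λ i → f i + g i)    ≡⟨ ∑-distrib-+ f g ⟩
  sum f + sum g            ≡⟨ cong₂ _+_ (sumFin≡sum f) (sumFin≡sum g) ⟨
  sumFin f + sumFin g      ∎
  where open ≡-Reasoning

sumFin-permute : ∀ {m} (f : Fin m → ℕ) (π : Permutation′ m) → sumFin (f ∘ (π ⟨$⟩ʳ_)) ≡ sumFin f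
sumFin-permute f π = begin
  sumFin (f ∘ (π ⟨$⟩ʳ_)) ≡⟨ sumFin≡sum (f ∘ (π ⟨$⟩ʳ_)) ⟩
  sum (f ∘ (π ⟨$⟩ʳ_))    ≡⟨ sum-permute f π ⟨
  sum f                  ≡⟨ sumFin≡sum f ⟨
  sumFin f               ∎
  where open ≡-Reasoning

module _ (X : MixedCayley) where
  open MixedCayley X

  sumV-cong : ∀ {f g : Vertex X → ℕ} → (∀ v → f v ≡ g v) → sumV X f ≡ sumV X g
  sumV-cong f≗g = cong₂ _+_ (sumFin-cong (λ g → f≗g (g , false))) (sumFin-cong (λ g → f≗g (g , true)))

  sumV-mono-≤ : ∀ {f g : Vertex X → ℕ} → (∀ v → f v ≤ g v) → sumV X f ≤ sumV X g
  sumV-mono-≤ f≤g = +-mono-≤ (sumFin-mono-≤ (λ g → f≤g (g , false))) (sumFin-mono-≤ (λ g → f≤g (g , true)))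

  sumV-mono-< : ∀ {f g : Vertex X → ℕ} → (∀ v → f v ≤ g v) → ∀ w → f w < g w → sumV X f < sumV X g
  sumV-mono-< f≤g (j , false) fw<gw =
    +-mono-<-≤ (sumFin-mono-< (λ g → f≤g (g , false)) j fw<gw) (sumFin-mono-≤ (λ g → f≤g (g , true)))
  sumV-mono-< f≤g (j , true) fw<gw =
    +-mono-≤-< (sumFin-mono-≤ (λ g → f≤g (g , false))) (sumFin-mono-< (λ g → f≤g (g , true)) j fw<gw)

  sumV-distrib-+ : ∀ (f g : Vertex X → ℕ) → sumV X (λ v → f v + g v) ≡ sumV X f + sumV X g
  sumV-distrib-+ f g =
    trans (cong₂ _+_ (sumFin-distrib-+ (λ h → f (h , false)) (λ h → g (h , false)))
                     (sumFin-distrib-+ (λ h → f (h , true)) (λ h → g (h , true))))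
          (interchange (sumFin (λ h → f (h , false))) _ (sumFin (λ h → f (h , true))) _)

  sumV-+-mono-≤ : ∀ (f₁ f₂ g₁ g₂ : Vertex X → ℕ) → (∀ v → f₁ v + f₂ v ≤ g₁ v + g₂ v)
    → sumV X f₁ + sumV X f₂ ≤ sumV X g₁ + sumV X g₂
  sumV-+-mono-≤ f₁ f₂ g₁ g₂ f≤g = subst₂ _≤_ (sumV-distrib-+ f₁ f₂) (sumV-distrib-+ g₁ g₂) (sumV-mono-≤ f≤g)

  countV-cong : ∀ {C D : VSubset X} → (∀ v → C v ≡ D v) → countV X C ≡ countV X D
  countV-cong C≗D = sumV-cong (cong 𝟙 ∘ C≗D)

  countV-∩-∪ : ∀ (C D : VSubset X) → countV X (C ∩ D) + countV X (C ∪ D) ≡ countV X C + countV X D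
  countV-∩-∪ C D = begin
    countV X (C ∩ D) + countV X (C ∪ D)         ≡⟨ sumV-distrib-+ (𝟙 ∘ (C ∩ D)) (𝟙 ∘ (C ∪ D)) ⟨
    sumV X (λ v → 𝟙 ((C ∩ D) v) + 𝟙 ((C ∪ D) v)) ≡⟨ sumV-cong (λ v → 𝟙-∧-∨ (C v) (D v)) ⟩
    sumV X (λ v → 𝟙 (C v) + 𝟙 (D v))             ≡⟨ sumV-distrib-+ (𝟙 ∘ C) (𝟙 ∘ D) ⟩
    countV X C + countV X D                       ∎
    where open ≡-Reasoning

  countV-∁ : ∀ (C : VSubset X) → countV X C + countV X (∁ C) ≡ countV X (λ _ → true)
  countV-∁ C = trans (sym (sumV-distrib-+ (𝟙 ∘ C) (𝟙 ∘ ∁ C))) (sumV-cong (𝟙-not ∘ C))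

  countV-mono-< : ∀ {C D : VSubset X} → C ⊆ D → ∀ w → C w ≡ false → D w ≡ true → countV X C < countV X D
  countV-mono-< {C} {D} C⊆D w Cw Dw =
    sumV-mono-< 𝟙C≤𝟙D w (subst₂ (λ c d → 𝟙 c < 𝟙 d) (sym Cw) (sym Dw) ≤-refl)
    where
    𝟙C≤𝟙D : ∀ v → 𝟙 (C v) ≤ 𝟙 (D v)
    𝟙C≤𝟙D v with C v in Cv
    ... | false = z≤n
    ... | true rewrite C⊆D v Cv = ≤-refl

  countV-pos : ∀ (C : VSubset X) w → C w ≡ true → 0 < countV X C
  countV-pos C w Cw = ≤-<-trans z≤n (countV-mono-< {C = λ _ → false} {D = C} (λ _ ()) w refl Cw)

  ⊆∧countV-≥⇒≗ : ∀ {C D : VSubset X} → C ⊆ D → countV X D ≤ countV X C → ∀ v → C v ≡ D v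
  ⊆∧countV-≥⇒≗ {C} {D} C⊆D |D|≤|C| v with C v in Cv | D v in Dv
  ... | false | false = refl
  ... | true  | true  = refl
  ... | true  | false = contradiction (trans (sym (C⊆D v Cv)) Dv) λ ()
  ... | false | true  = contradiction |D|≤|C| (<⇒≱ (countV-mono-< C⊆D v Cv Dv))

  outside-of-layer : ∀ (C : VSubset X) i → ¬ (∀ g → C (g , i) ≡ true) → ∃ λ v → C v ≡ false
  outside-of-layer C i ¬full =
    let g , g∉C = ¬∀⟶∃¬ n _ (λ g → C (g , i) ≟ true) ¬full in (g , i) , ¬-not g∉C

  full-or-outside : (C : VSubset X) → (∀ v → C v ≡ true) ⊎ (∃ λ v → C v ≡ false)
  full-or-outside C with all? (λ g → C (g , false) ≟ true) | all? (λ g → C (g , true) ≟ true)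
  ... | yes full₀ | yes full₁ = inj₁ λ { (g , false) → full₀ g ; (g , true) → full₁ g }
  ... | no ¬full₀ | _         = inj₂ (outside-of-layer C false ¬full₀)
  ... | yes _     | no ¬full₁ = inj₂ (outside-of-layer C true ¬full₁)

  countV-<-full⇒∉ : ∀ (C : VSubset X) → countV X C < countV X (λ _ → true) → ∃ λ v → C v ≡ false
  countV-<-full⇒∉ C |C|<|V| with full-or-outside C
  ... | inj₁ full = contradiction (countV-cong full) (<⇒≢ |C|<|V|)
  ... | inj₂ v∉C  = v∉C

module _ (X : MixedCayley) where

  countPairs-cong : ∀ {r s : Vertex X → Vertex X → Bool} → (∀ u v → r u v ≡ s u v)
    → countPairs X r ≡ countPairs X s
  countPairs-cong r≗s = sumV-cong X (λ u → countV-cong X (r≗s u))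

  arcsIn-+-mono-≤ : ∀ (F₁ F₂ G₁ G₂ : Vertex X → Vertex X → Bool)
    → (∀ u v → let x = arc X u v in
         𝟙 (x ∧ F₁ u v) + 𝟙 (x ∧ F₂ u v) ≤ 𝟙 (x ∧ G₁ u v) + 𝟙 (x ∧ G₂ u v))
    → arcsIn X F₁ + arcsIn X F₂ ≤ arcsIn X G₁ + arcsIn X G₂
  arcsIn-+-mono-≤ F₁ F₂ G₁ G₂ F≤G =
    sumV-+-mono-≤ X (λ u → countV X (arcs F₁ u)) (λ u → countV X (arcs F₂ u))
                  (λ u → countV X (arcs G₁ u)) (λ u → countV X (arcs G₂ u))
      (λ u → sumV-+-mono-≤ X (𝟙 ∘ arcs F₁ u) (𝟙 ∘ arcs F₂ u) (𝟙 ∘ arcs G₁ u) (𝟙 ∘ arcs G₂ u) (F≤G u))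
    where
    arcs : (Vertex X → Vertex X → Bool) → Vertex X → Vertex X → Bool
    arcs F u v = arc X u v ∧ F u v

  leaving : VSubset X → Vertex X → Vertex X → Bool
  leaving C u v = cut (C u) (C v)

  ωout≡arcsIn-leaving : ∀ (C : VSubset X) → ωout X C ≡ arcsIn X (leaving C)
  ωout≡arcsIn-leaving C = countPairs-cong λ u v →
    trans (sym (∧-assoc (C u) (not (C v)) (arc X u v))) (∧-comm (leaving C u v) (arc X u v))

  ωout-cong : ∀ {C D : VSubset X} → (∀ v → C v ≡ D v) → ωout X C ≡ ωout X D
  ωout-cong C≗D = countPairs-cong λ u v → cong₂ (λ a b → a ∧ not b ∧ arc X u v) (C≗D u) (C≗D v)

  ωout-∁ : ∀ (C : VSubset X) → ωout X (∁ C) ≡ ωin X C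
  ωout-∁ C = countPairs-cong λ u v → cong (λ b → not (C u) ∧ b ∧ arc X u v) (not-involutive (C v))

  ωin-∁ : ∀ (C : VSubset X) → ωin X (∁ C) ≡ ωout X C
  ωin-∁ C = countPairs-cong λ u v → cong (λ a → a ∧ not (C v) ∧ arc X u v) (not-involutive (C u))

  ωout-submodular : ∀ (C D : VSubset X) → ωout X (C ∩ D) + ωout X (C ∪ D) ≤ ωout X C + ωout X D
  ωout-submodular C D = begin
    ωout X (C ∩ D) + ωout X (C ∪ D)
      ≡⟨ cong₂ _+_ (ωout≡arcsIn-leaving (C ∩ D)) (ωout≡arcsIn-leaving (C ∪ D)) ⟩
    arcsIn X (leaving (C ∩ D)) + arcsIn X (leaving (C ∪ D))
      ≤⟨ arcsIn-+-mono-≤ (leaving (C ∩ D)) (leaving (C ∪ D)) (leaving C) (leaving D)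
           (λ u v → 𝟙-cut-submodular (arc X u v) (C u) (D u) (C v) (D v)) ⟩
    arcsIn X (leaving C) + arcsIn X (leaving D)
      ≡⟨ cong₂ _+_ (ωout≡arcsIn-leaving C) (ωout≡arcsIn-leaving D) ⟨
    ωout X C + ωout X D
      ∎
    where open ≤-Reasoning

  ωin-submodular : ∀ (C D : VSubset X) → ωin X (C ∩ D) + ωin X (C ∪ D) ≤ ωin X C + ωin X D
  ωin-submodular C D = begin
    ωin X (C ∩ D) + ωin X (C ∪ D)               ≡⟨ cong₂ _+_ (ωout-∁ (C ∩ D)) (ωout-∁ (C ∪ D)) ⟨
    ωout X (∁ (C ∩ D)) + ωout X (∁ (C ∪ D))     ≡⟨ cong₂ _+_ (ωout-cong (λ v → not-∧ (C v) (D v)))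
                                                             (ωout-cong (λ v → not-∨ (C v) (D v))) ⟩
    ωout X (∁ C ∪ ∁ D) + ωout X (∁ C ∩ ∁ D)     ≡⟨ +-comm (ωout X (∁ C ∪ ∁ D)) _ ⟩
    ωout X (∁ C ∩ ∁ D) + ωout X (∁ C ∪ ∁ D)     ≤⟨ ωout-submodular (∁ C) (∁ D) ⟩
    ωout X (∁ C) + ωout X (∁ D)                 ≡⟨ cong₂ _+_ (ωout-∁ C) (ωout-∁ D) ⟩
    ωin X C + ωin X D                           ∎
    where open ≤-Reasoning

  ∁-ProperNonempty : ∀ {C : VSubset X} → ProperNonempty X C → ProperNonempty X (∁ C)
  ∁-ProperNonempty ((u , Cu) , (v , Cv)) = (v , cong not Cv) , (u , cong not Cu)

  deleting-leaving-disconnects : ∀ {C : VSubset X} → ProperNonempty X C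
    → ¬ StronglyConnectedRel X (deleteArcs X (leaving C))
  deleting-leaving-disconnects {C} ((u , Cu) , (v , Cv)) strong =
    contradiction (trans (sym (stays-in-C (strong u v) Cu)) Cv) λ ()
    where
    stays-in-C : ∀ {x y} → Star (λ a b → T (deleteArcs X (leaving C) a b)) x y → C x ≡ true → C y ≡ true
    stays-in-C = fold (λ x y → C x ≡ true → C y ≡ true)
                      (λ {x} {y} step rest Cx → rest (uncut-true⇒true (arc X x y) (C x) (C y) step Cx)) id

  arcConnectivity≤ωout : ∀ {k} → IsArcConnectivity X k
    → ∀ (C : VSubset X) → ProperNonempty X C → k ≤ ωout X C
  arcConnectivity≤ωout {k} (_ , minimal) C C≠∅,V =
    subst (k ≤_) (sym (ωout≡arcsIn-leaving C)) (minimal (leaving C) (deleting-leaving-disconnects C≠∅,V))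

  arcConnectivity≤ωin : ∀ {k} → IsArcConnectivity X k
    → ∀ (C : VSubset X) → ProperNonempty X C → k ≤ ωin X C
  arcConnectivity≤ωin {k} conn C C≠∅,V =
    subst (k ≤_) (ωout-∁ C) (arcConnectivity≤ωout conn (∁ C) (∁-ProperNonempty C≠∅,V))

module _ (X : MixedCayley) where
  open MixedCayley X

  group : Group 0ℓ 0ℓ
  group = record { isGroup = isGroup }

  open GroupProperties group using (\\-leftDividesˡ; //-rightDividesˡ; //-rightDividesʳ; ⁻¹-anti-homo-∙)
  open IsGroup isGroup using (assoc)

  translate : Fin n → Vertex X → Vertex X
  translate c (g , i) = (g ∙ c , i)

  translate-inverseˡ : ∀ c v → translate c (translate (c ⁻¹) v) ≡ v
  translate-inverseˡ c (g , i) = cong (_, i) (//-rightDividesˡ c g)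

  translate-inverseʳ : ∀ c v → translate (c ⁻¹) (translate c v) ≡ v
  translate-inverseʳ c (g , i) = cong (_, i) (//-rightDividesʳ c g)

  translate-quotient : ∀ g h i → translate ((g ⁻¹) ∙ h) (g , i) ≡ (h , i)
  translate-quotient g h i = cong (_, i) (\\-leftDividesˡ g h)

  translation : Fin n → Permutation′ n
  translation c = permutation (_∙ c) (_∙ (c ⁻¹)) (//-rightDividesˡ c) (//-rightDividesʳ c)

  quotient-translate : ∀ c h g → (h ∙ c) ∙ ((g ∙ c) ⁻¹) ≡ h ∙ (g ⁻¹)
  quotient-translate c h g = begin
    (h ∙ c) ∙ ((g ∙ c) ⁻¹)       ≡⟨ cong ((h ∙ c) ∙_) (⁻¹-anti-homo-∙ g c) ⟩
    (h ∙ c) ∙ ((c ⁻¹) ∙ (g ⁻¹))  ≡⟨ assoc (h ∙ c) (c ⁻¹) (g ⁻¹) ⟨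
    ((h ∙ c) ∙ (c ⁻¹)) ∙ (g ⁻¹)  ≡⟨ cong (_∙ (g ⁻¹)) (//-rightDividesʳ c h) ⟩
    h ∙ (g ⁻¹)                   ∎
    where open ≡-Reasoning

  arc-translate : ∀ c u v → arc X (translate c u) (translate c v) ≡ arc X u v
  arc-translate c (g , false) (h , false) = cong S₀ (quotient-translate c h g)
  arc-translate c (g , true)  (h , true)  = cong S₁ (quotient-translate c h g)
  arc-translate c (g , false) (h , true)  = cong T₀ (quotient-translate c h g)
  arc-translate c (h , true)  (g , false) = cong T₁ (quotient-translate c h g)

  sumV-translate : ∀ c (f : Vertex X → ℕ) → sumV X (f ∘ translate c) ≡ sumV X f
  sumV-translate c f = cong₂ _+_ (sumFin-permute (λ g → f (g , false)) (translation c))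
                                 (sumFin-permute (λ g → f (g , true)) (translation c))

  countV-translate : ∀ c (C : VSubset X) → countV X (C ∘ translate c) ≡ countV X C
  countV-translate c C = sumV-translate c (𝟙 ∘ C)

  countPairs-translate : ∀ c (r : Vertex X → Vertex X → Bool)
    → countPairs X (λ u v → r (translate c u) (translate c v)) ≡ countPairs X r
  countPairs-translate c r = trans (sumV-cong X (λ u → countV-translate c (r (translate c u))))
                                   (sumV-translate c (countV X ∘ r))

  ωout-translate : ∀ c (C : VSubset X) → ωout X (C ∘ translate c) ≡ ωout X C
  ωout-translate c C = trans
    (countPairs-cong X λ u v →
      cong (λ x → C (translate c u) ∧ not (C (translate c v)) ∧ x) (sym (arc-translate c u v)))
    (countPairs-translate c (λ u v → C u ∧ not (C v) ∧ arc X u v))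

  ωin-translate : ∀ c (C : VSubset X) → ωin X (C ∘ translate c) ≡ ωin X C
  ωin-translate c C = trans (sym (ωout-∁ X (C ∘ translate c))) (trans (ωout-translate c (∁ C)) (ωout-∁ X C))

module _ (X : MixedCayley) (ω : VSubset X → ℕ) (k : ℕ)
  (k≤ω : ∀ C → ProperNonempty X C → k ≤ ω C)
  (ω-submodular : ∀ C D → ω (C ∩ D) + ω (C ∪ D) ≤ ω C + ω D) where

  intersecting-minimum-cuts-coincide : ∀ A B → ω A ≡ k → ω B ≡ k
    → (∀ C → ProperNonempty X C → ω C ≡ k → countV X A ≤ countV X C)
    → countV X A ≤ countV X (∁ A) → countV X B ≡ countV X A
    → ∀ y → A y ≡ true → B y ≡ true → ∀ v → A v ≡ B v
  intersecting-minimum-cuts-coincide A B ωA ωB minimum |A|≤|∁A| |B|≡|A| y Ay By v =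
    trans (sym (⊆∧countV-≥⇒≗ X (∩-⊆ˡ A B) |A|≤|A∩B| v))
          (⊆∧countV-≥⇒≗ X (∩-⊆ʳ A B) (subst (_≤ countV X (A ∩ B)) (sym |B|≡|A|) |A|≤|A∩B|) v)
    where
    y∈A∩B : (A ∩ B) y ≡ true
    y∈A∩B rewrite Ay = By

    |A∪B|<|V| : countV X (A ∪ B) < countV X (λ _ → true)
    |A∪B|<|V| = begin-strict
      countV X (A ∪ B)                    <⟨ m<n+m _ (countV-pos X (A ∩ B) y y∈A∩B) ⟩
      countV X (A ∩ B) + countV X (A ∪ B) ≡⟨ countV-∩-∪ X A B ⟩
      countV X A + countV X B             ≡⟨ cong (countV X A +_) |B|≡|A| ⟩
      countV X A + countV X A             ≤⟨ +-monoʳ-≤ (countV X A) |A|≤|∁A| ⟩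
      countV X A + countV X (∁ A)         ≡⟨ countV-∁ X A ⟩
      countV X (λ _ → true)               ∎
      where open ≤-Reasoning

    w∉A∪B : ∃ λ w → (A ∪ B) w ≡ false
    w∉A∪B = countV-<-full⇒∉ X (A ∪ B) |A∪B|<|V|

    A∪B≠∅,V : ProperNonempty X (A ∪ B)
    A∪B≠∅,V = (y , ∩-⊆-∪ A B y y∈A∩B) , w∉A∪B

    A∩B≠∅,V : ProperNonempty X (A ∩ B)
    A∩B≠∅,V = (y , y∈A∩B) , (proj₁ w∉A∪B , ⊆-∉ (∩-⊆-∪ A B) (proj₁ w∉A∪B) (proj₂ w∉A∪B))

    ω[A∩B]≤k : ω (A ∩ B) ≤ k
    ω[A∩B]≤k = +-cancelʳ-≤ k (ω (A ∩ B)) k (begin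
      ω (A ∩ B) + k         ≤⟨ +-monoʳ-≤ (ω (A ∩ B)) (k≤ω (A ∪ B) A∪B≠∅,V) ⟩
      ω (A ∩ B) + ω (A ∪ B) ≤⟨ ω-submodular A B ⟩
      ω A + ω B             ≡⟨ cong₂ _+_ ωA ωB ⟩
      k + k                 ∎)
      where open ≤-Reasoning

    |A|≤|A∩B| : countV X A ≤ countV X (A ∩ B)
    |A|≤|A∩B| = minimum (A ∩ B) A∩B≠∅,V (≤-antisym ω[A∩B]≤k (k≤ω (A ∩ B) A∩B≠∅,V))

module _ (X : MixedCayley) where
  open MixedCayley X using (n; _∙_; _⁻¹)

  atom-translate-invariant : ∀ {k} → IsArcConnectivity X k → ∀ {A} → IsLambdaAtom X k A
    → ∀ c w → A w ≡ true → A (translate X c w) ≡ true → ∀ v → A v ≡ A (translate X c v)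
  -- The complement of a positive fragment is a negative one and vice versa, so an atom
  -- contains at most half of the vertices.
  atom-translate-invariant conn {A} (inj₁ (A≠∅,V , ωA) , minimum) c =
    intersecting-minimum-cuts-coincide X (ωout X) _ (arcConnectivity≤ωout X conn) (ωout-submodular X)
      A (A ∘ translate X c) ωA (trans (ωout-translate X c A) ωA)
      (λ C C≠∅,V ωC → minimum C (inj₁ (C≠∅,V , ωC)))
      (minimum (∁ A) (inj₂ (∁-ProperNonempty X A≠∅,V , trans (ωin-∁ X A) ωA)))
      (countV-translate X c A)
  atom-translate-invariant conn {A} (inj₂ (A≠∅,V , ωA) , minimum) c =
    intersecting-minimum-cuts-coincide X (ωin X) _ (arcConnectivity≤ωin X conn) (ωin-submodular X)
      A (A ∘ translate X c) ωA (trans (ωin-translate X c A) ωA)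
      (λ C C≠∅,V ωC → minimum C (inj₂ (C≠∅,V , ωC)))
      (minimum (∁ A) (inj₁ (∁-ProperNonempty X A≠∅,V , trans (ωout-∁ X A) ωA)))
      (countV-translate X c A)

  induced-≡ : ∀ {A} {x y : InducedVertex X A} → proj₁ x ≡ proj₁ y → x ≡ y
  induced-≡ {A} {v , p} {v , q} refl = cong (v ,_) (T-irrelevant p q)

  translate-automorphism : ∀ A c → (∀ v → A v ≡ A (translate X c v))
    → Σ (InducedVertex X A → InducedVertex X A) λ f
      → IsAutomorphism X A f × (∀ x → proj₁ (f x) ≡ translate X c (proj₁ x))
  translate-automorphism A c A-invariant = f , ((f-injective , f-surjective) , f-arcs) , λ _ → refl
    where
    f : InducedVertex X A → InducedVertex X A
    f (v , v∈A) = translate X c v , subst T (A-invariant v) v∈A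

    f-injective : ∀ {x y} → f x ≡ f y → x ≡ y
    f-injective {u , _} {v , _} fx≡fy = induced-≡ (begin
      u                                       ≡⟨ translate-inverseʳ X c u ⟨
      translate X (c ⁻¹) (translate X c u)    ≡⟨ cong (translate X (c ⁻¹) ∘ proj₁) fx≡fy ⟩
      translate X (c ⁻¹) (translate X c v)    ≡⟨ translate-inverseʳ X c v ⟩
      v                                       ∎)
      where open ≡-Reasoning

    f-surjective : ∀ y → ∃ λ x → ∀ {z} → z ≡ x → f z ≡ y
    f-surjective (v , v∈A) =
      (translate X (c ⁻¹) v , preimage∈A) , λ { refl → induced-≡ (translate-inverseˡ X c v) }
      where
      preimage∈A : T (A (translate X (c ⁻¹) v))
      preimage∈A = subst T (sym (trans (A-invariant _) (cong A (translate-inverseˡ X c v)))) v∈A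

    f-arcs : ∀ x y → arc X (proj₁ x) (proj₁ y) ≡ arc X (proj₁ (f x)) (proj₁ (f y))
    f-arcs (u , _) (v , _) = sym (arc-translate X c u v)

  atom-layer-transitive : ∀ {k} → IsArcConnectivity X k → ∀ {A} → IsLambdaAtom X k A
    → ∀ i → AutTransitiveOnLayer X A i
  atom-layer-transitive conn {A} atom i ((g , i) , x∈A) ((h , i) , y∈A) refl refl =
    let f , f-automorphism , f≗translate = translate-automorphism A c A-invariant
    in f , f-automorphism , induced-≡ (trans (f≗translate ((g , i) , x∈A)) g↦h)
    where
    c : Fin n
    c = (g ⁻¹) ∙ h

    g↦h : translate X c (g , i) ≡ (h , i)
    g↦h = translate-quotient X g h i

    A-invariant : ∀ v → A v ≡ A (translate X c v)
    A-invariant = atom-translate-invariant conn atom c (g , i)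
      (Equivalence.to T-≡ x∈A) (trans (cong A g↦h) (Equivalence.to T-≡ y∈A))

proposition3p6 : (X : MixedCayley) → StronglyConnected X
    → (k d : ℕ) → IsArcConnectivity X k → IsMinDegree X d → k < d
    → (A : VSubset X) → IsLambdaAtom X k A
    → AutTransitiveOnLayer X A false × AutTransitiveOnLayer X A true
proposition3p6 X _ _ _ conn _ _ _ atom = atom-layer-transitive X conn atom false , atom-layer-transitive X conn atom true
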